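{- Let $\{V_j\}_{j\ge1}$ be a sequence of positive integers with $V_j=V_{j-1}+V_{j-2}$ for $j\ge3$, let $n\ge1$, and let $d\ge2$ be even. For every positive integer $m$, $s(m)<s(m+1)$.
   Context: $F_j$ is the $j$-th Fibonacci number ($F_0=0,F_1=F_2=1$); $F_d\mid F_{jd}$ for $j\ge1$. The function $s$ is defined for a positive integer $x$ as follows: let $k\ge1$ satisfy $F_{kd}/F_d\le x<F_{(k+1)d}/F_d$; set $\lambda_k=\lfloor x/(F_{kd}/F_d)\rfloor$ and, for $j=k-1,\ldots,1$, $\lambda_j=\left\lfloor \big(x-\sum_{i=j+1}^k\lambda_iF_{id}/F_d\big)/(F_{jd}/F_d)\right\rfloor$; then $s(x)=\sum_{i=1}^k\lambda_iV_{n+id}$. -}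

module Defs where

open import Data.Nat using (ℕ; zero; suc; _+_; _*_; _∸_; _≤?_; pred)
open import Data.Nat.DivMod using (_/_)
open import Relation.Nullary using (yes; no)

F : ℕ → ℕ
F zero = zero
F (suc zero) = suc zero
F (suc (suc j)) = F (suc j) + F j

-- natural-number quotient m / n, with the divisor read as n whenever n ≥ 1
-- (only ever applied with n = F d ≥ 1, since d ≥ 2)
_div_ : ℕ → ℕ → ℕ
m div n = m / suc (pred n)

G : ℕ → ℕ → ℕ
G d i = F (i * d) div F d

findK : ℕ → ℕ → ℕ → ℕ
findK d x zero = zero
findK d x (suc i) with G d (suc i) ≤? x
... | yes _ = suc i
... | no _ = findK d x i

-- the index k with F_{kd}/F_d ≤ x < F_{(k+1)d}/F_d  (G d is increasing, G d j ≥ j,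
-- so k is the largest j ≤ x with G d j ≤ x)
kIdx : ℕ → ℕ → ℕ
kIdx d x = findK d x x

-- greedy digits: sAux V n d j r = Σ_{i=1}^{j} λ_i V_{n+id}, where
-- λ_j = ⌊ r / G d j ⌋ and r is the remainder x − Σ_{i>j} λ_i G d i
sAux : (ℕ → ℕ) → ℕ → ℕ → ℕ → ℕ → ℕ
sAux V n d zero r = zero
sAux V n d (suc j) r =
  (r div G d (suc j)) * V (n + suc j * d)
  + sAux V n d j (r ∸ (r div G d (suc j)) * G d (suc j))

s : (ℕ → ℕ) → ℕ → ℕ → ℕ → ℕ
s V n d x = sAux V n d (kIdx d x) x

{-# OPTIONS --safe #-}
module Submission where

-- Let w i = V (n + i d) and g i = F (i d) / F d.  For even d, Cassini's identity
-- F (d + 1) F (d - 1) = F d ^ 2 + 1 makes both sequences satisfy u (i + 2) + u i = L u (i + 1)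
-- with L = F (d - 1) + F (d + 1), and then w (i + 1) + w 0 g i = w 1 g (i + 1).  Summing this
-- over the greedy digits of x in the base g gives s x + w 0 (shifted x) = w 1 x, where shifted x
-- is the digit sum of x with every g (i + 1) replaced by g i.  Since shifted grows by at most one
-- from x to x + 1 and w 0 < w 1, s is strictly increasing.

open import Defs
open import Data.Nat using (ℕ; zero; suc; pred; _+_; _*_; _∸_; _≤_; _<_; z≤n; s≤s; _≤?_; NonZero; >-nonZero)
open import Data.Nat.Properties
open import Data.Nat.DivMod using (_/_; m/n*n≤m; m%n≡m∸m/n*n; m%n<n; +-distrib-/-∣ˡ; m*n/n≡m; m<n⇒m/n≡0; n/1≡n; m/n*n≡m)
open import Data.Nat.Divisibility using (_∣_; divides; _∣0; n∣m*n; m∣m*n; ∣n⇒∣m*n; ∣m∣n⇒∣m+n)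
open import Data.Nat.Tactic.RingSolver using (solve-∀)
open import Data.Product using (∃-syntax; _×_; _,_; proj₁)
open import Data.Sum using (inj₁; inj₂)
open import Relation.Nullary using (yes; no)
open import Relation.Binary.PropositionalEquality using (_≡_; refl; sym; trans; cong; cong₂; subst; subst₂; module ≡-Reasoning)

m-div-n*n≤m : ∀ m n → m div n * n ≤ m
m-div-n*n≤m m zero    = ≤-trans (≤-reflexive (*-zeroʳ (m div 0))) z≤n
m-div-n*n≤m m (suc n) = m/n*n≤m m (suc n)

m∸m-div-n*n<n : ∀ m n → 0 < n → m ∸ m div n * n < n
m∸m-div-n*n<n m (suc n) _ = subst (_< suc n) (m%n≡m∸m/n*n m (suc n)) (m%n<n m (suc n))

[m*n+o]-div-n≡m : ∀ m n o → o < n → (m * n + o) div n ≡ m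
[m*n+o]-div-n≡m m n@(suc _) o o<n = begin
  (m * n + o) / n   ≡⟨ +-distrib-/-∣ˡ o (n∣m*n m) ⟩
  m * n / n + o / n ≡⟨ cong₂ _+_ (m*n/n≡m m n) (m<n⇒m/n≡0 o<n) ⟩
  m + 0             ≡⟨ +-identityʳ m ⟩
  m                 ∎
  where open ≡-Reasoning

m-div-n*n≡m : ∀ {m} n → 0 < n → n ∣ m → m div n * n ≡ m
m-div-n*n≡m (suc n) _ n∣m = m/n*n≡m n∣m

digitSum : (g w : ℕ → ℕ) → ℕ → ℕ → ℕ
digitSum g w zero    r = 0
digitSum g w (suc j) r = r div g (suc j) * w (suc j) + digitSum g w j (r ∸ r div g (suc j) * g (suc j))

sAux≡digitSum : ∀ V n d j r → sAux V n d j r ≡ digitSum (G d) (λ i → V (n + i * d)) j r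
sAux≡digitSum V n d zero    r = refl
sAux≡digitSum V n d (suc j) r = cong (r div G d (suc j) * V (n + suc j * d) +_) (sAux≡digitSum V n d j _)

digitSum-zero : ∀ g w j → digitSum g w j 0 ≡ 0
digitSum-zero g w zero    = refl
digitSum-zero g w (suc j) = digitSum-zero g w j

digitSum-digit : ∀ g w j q ρ → ρ < g (suc j) →
                 digitSum g w (suc j) (q * g (suc j) + ρ) ≡ q * w (suc j) + digitSum g w j ρ
digitSum-digit g w j q ρ ρ<g
  rewrite [m*n+o]-div-n≡m q (g (suc j)) ρ ρ<g | m+n∸m≡n (q * g (suc j)) ρ = refl

digitSum-self : ∀ g → g 1 ≡ 1 → ∀ j r → digitSum g g (suc j) r ≡ r
digitSum-self g g1 zero r rewrite g1 = trans (+-identityʳ _) (trans (*-identityʳ _) (n/1≡n r))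
digitSum-self g g1 (suc j) r =
  trans (cong (q * g (2 + j) +_) (digitSum-self g g1 j _)) (m+[n∸m]≡n (m-div-n*n≤m r (g (2 + j))))
  where q = r div g (2 + j)

digitSum-linear : ∀ g {w u v} a b → (∀ i → w (suc i) + a * u (suc i) ≡ b * v (suc i)) →
                  ∀ j r → digitSum g w j r + a * digitSum g u j r ≡ b * digitSum g v j r
digitSum-linear g a b rel zero    r = trans (*-zeroʳ a) (sym (*-zeroʳ b))
digitSum-linear g {w} {u} {v} a b rel (suc j) r = begin
  (q * w (suc j) + S w) + a * (q * u (suc j) + S u) ≡⟨ collect q (w (suc j)) (S w) a (u (suc j)) (S u) ⟩
  q * (w (suc j) + a * u (suc j)) + (S w + a * S u) ≡⟨ cong₂ (λ x y → q * x + y) (rel j) (digitSum-linear g a b rel j r′) ⟩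
  q * (b * v (suc j)) + b * S v                     ≡⟨ factor q b (v (suc j)) (S v) ⟩
  b * (q * v (suc j) + S v)                         ∎
  where
  open ≡-Reasoning
  q  = r div g (suc j)
  r′ = r ∸ q * g (suc j)
  S : (ℕ → ℕ) → ℕ
  S x = digitSum g x j r′
  collect : ∀ q x s a y t → (q * x + s) + a * (q * y + t) ≡ q * (x + a * y) + (s + a * t)
  collect = solve-∀
  factor : ∀ q b x s → q * (b * x) + b * s ≡ b * (q * x + s)
  factor = solve-∀

Recurrent : ℕ → (ℕ → ℕ) → Set
Recurrent L u = ∀ i → u (2 + i) + u i ≡ L * u (1 + i)

Recurrent-zero : ∀ {L} → Recurrent L (λ _ → 0)
Recurrent-zero {L} i = sym (*-zeroʳ L)

Recurrent-+* : ∀ {L u v} a → Recurrent L u → Recurrent L v → Recurrent L (λ i → u i + a * v i)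
Recurrent-+* {L} {u} {v} a ru rv i = begin
  (u (2 + i) + a * v (2 + i)) + (u i + a * v i) ≡⟨ regroup (u (2 + i)) (u i) a (v (2 + i)) (v i) ⟩
  (u (2 + i) + u i) + a * (v (2 + i) + v i)     ≡⟨ cong₂ (λ x y → x + a * y) (ru i) (rv i) ⟩
  L * u (1 + i) + a * (L * v (1 + i))           ≡⟨ factor L (u (1 + i)) a (v (1 + i)) ⟩
  L * (u (1 + i) + a * v (1 + i))               ∎
  where
  open ≡-Reasoning
  regroup : ∀ x y a z t → (x + a * z) + (y + a * t) ≡ (x + y) + a * (z + t)
  regroup = solve-∀
  factor : ∀ L x a y → L * x + a * (L * y) ≡ L * (x + a * y)
  factor = solve-∀

Recurrent-cancel : ∀ {L u v} c .{{_ : NonZero c}} → (∀ i → u i * c ≡ v i) → Recurrent L v → Recurrent L u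
Recurrent-cancel {L} {u} {v} c u*c≡v rv i = *-cancelʳ-≡ _ _ c (begin
  (u (2 + i) + u i) * c       ≡⟨ *-distribʳ-+ c (u (2 + i)) (u i) ⟩
  u (2 + i) * c + u i * c     ≡⟨ cong₂ _+_ (u*c≡v (2 + i)) (u*c≡v i) ⟩
  v (2 + i) + v i             ≡⟨ rv i ⟩
  L * v (1 + i)               ≡⟨ cong (L *_) (sym (u*c≡v (1 + i))) ⟩
  L * (u (1 + i) * c)         ≡⟨ sym (*-assoc L (u (1 + i)) c) ⟩
  L * u (1 + i) * c           ∎)
  where open ≡-Reasoning

Recurrent-unique : ∀ {L u v} → Recurrent L u → Recurrent L v → u 0 ≡ v 0 → u 1 ≡ v 1 → ∀ i → u i ≡ v i
Recurrent-unique {L} {u} {v} ru rv u0≡v0 u1≡v1 i = proj₁ (agree i)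
  where
  agree : ∀ i → u i ≡ v i × u (suc i) ≡ v (suc i)
  agree zero    = u0≡v0 , u1≡v1
  agree (suc i) with agree i
  ... | ui≡vi , u1+i≡v1+i = u1+i≡v1+i , +-cancelʳ-≡ (u i) _ _ (begin
    u (2 + i) + u i ≡⟨ ru i ⟩
    L * u (1 + i)   ≡⟨ cong (L *_) u1+i≡v1+i ⟩
    L * v (1 + i)   ≡⟨ sym (rv i) ⟩
    v (2 + i) + v i ≡⟨ cong (v (2 + i) +_) (sym ui≡vi) ⟩
    v (2 + i) + u i ∎)
    where open ≡-Reasoning

Recurrent-decompose : ∀ {L w g} → Recurrent L w → Recurrent L g → g 0 ≡ 0 → g 1 ≡ 1 →
                      ∀ i → w (suc i) + w 0 * g i ≡ w 1 * g (suc i)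
Recurrent-decompose {L} {w} {g} rw rg g0 g1 =
  -- the 0 + makes the right-hand side an instance of Recurrent-+*
  Recurrent-unique {L} {u = λ i → w (suc i) + w 0 * g i} {v = λ i → 0 + w 1 * g (suc i)}
    (Recurrent-+* {L} {u = λ i → w (suc i)} {v = g} (w 0) (λ i → rw (suc i)) rg)
    (Recurrent-+* {L} {u = λ _ → 0} {v = λ i → g (suc i)} (w 1) (Recurrent-zero {L}) (λ i → rg (suc i)))
    at0 at1
  where
  open ≡-Reasoning
  at0 : w 1 + w 0 * g 0 ≡ w 1 * g 1
  at0 rewrite g0 | g1 = trans (cong (w 1 +_) (*-zeroʳ (w 0))) (trans (+-identityʳ (w 1)) (sym (*-identityʳ (w 1))))
  g2≡L : g 2 ≡ L
  g2≡L = begin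
    g 2       ≡⟨ sym (+-identityʳ (g 2)) ⟩
    g 2 + 0   ≡⟨ cong (g 2 +_) (sym g0) ⟩
    g 2 + g 0 ≡⟨ rg 0 ⟩
    L * g 1   ≡⟨ cong (L *_) g1 ⟩
    L * 1     ≡⟨ *-identityʳ L ⟩
    L         ∎
  at1 : w 2 + w 0 * g 1 ≡ w 1 * g 2
  at1 = begin
    w 2 + w 0 * g 1 ≡⟨ cong (λ x → w 2 + w 0 * x) g1 ⟩
    w 2 + w 0 * 1   ≡⟨ cong (w 2 +_) (*-identityʳ (w 0)) ⟩
    w 2 + w 0       ≡⟨ rw 0 ⟩
    L * w 1         ≡⟨ *-comm L (w 1) ⟩
    w 1 * L         ≡⟨ cong (w 1 *_) (sym g2≡L) ⟩
    w 1 * g 2       ∎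

<-from-linear-identities : ∀ {S₀ S₁ T₀ T₁ A B m} → S₀ + A * T₀ ≡ B * m → S₁ + A * T₁ ≡ B * suc m →
                           T₁ ≤ suc T₀ → A < B → S₀ < S₁
<-from-linear-identities {S₀} {S₁} {T₀} {T₁} {A} {B} {m} e₀ e₁ T₁≤1+T₀ A<B = +-cancelʳ-< (A * T₁) S₀ S₁ (begin-strict
  S₀ + A * T₁        ≤⟨ +-monoʳ-≤ S₀ (*-monoʳ-≤ A T₁≤1+T₀) ⟩
  S₀ + A * suc T₀    ≡⟨ regroup S₀ A T₀ ⟩
  A + (S₀ + A * T₀)  <⟨ +-monoˡ-< (S₀ + A * T₀) A<B ⟩
  B + (S₀ + A * T₀)  ≡⟨ cong (B +_) e₀ ⟩
  B + B * m          ≡⟨ sym (*-suc B m) ⟩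
  B * suc m          ≡⟨ sym e₁ ⟩
  S₁ + A * T₁        ∎)
  where
  open ≤-Reasoning
  regroup : ∀ s a t → s + a * (1 + t) ≡ a + (s + a * t)
  regroup = solve-∀

module Greedy (g : ℕ → ℕ) (M : ℕ) (g0 : g 0 ≡ 0) (g1 : g 1 ≡ 1) (g-rec : Recurrent (2 + M) g) where

  g-< : ∀ i → g i < g (suc i)
  g-< zero    = subst₂ _<_ (sym g0) (sym g1) (s≤s z≤n)
  g-< (suc i) = +-cancelʳ-< (g i) (g (1 + i)) (g (2 + i)) (begin-strict
    g (1 + i) + g i          <⟨ +-monoʳ-< (g (1 + i)) (g-< i) ⟩
    g (1 + i) + g (1 + i)    ≤⟨ +-monoʳ-≤ (g (1 + i)) (m≤m+n (g (1 + i)) (M * g (1 + i))) ⟩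
    (2 + M) * g (1 + i)      ≡⟨ sym (g-rec i) ⟩
    g (2 + i) + g i          ∎)
    where open ≤-Reasoning

  g-mono : ∀ i k → g i ≤ g (i + k)
  g-mono i zero    = ≤-reflexive (cong g (sym (+-identityʳ i)))
  g-mono i (suc k) = ≤-trans (g-mono i k) (≤-trans (<⇒≤ (g-< (i + k))) (≤-reflexive (cong g (sym (+-suc i k)))))

  i<g[1+i] : ∀ i → i < g (suc i)
  i<g[1+i] zero    = subst (0 <_) (sym g1) (s≤s z≤n)
  i<g[1+i] (suc i) = ≤-<-trans (i<g[1+i] i) (g-< (suc i))

  digitSum-extend : ∀ w j k r → r < g (suc j) → digitSum g w (j + k) r ≡ digitSum g w j r
  digitSum-extend w j zero    r r<g = cong (λ x → digitSum g w x r) (+-identityʳ j)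
  digitSum-extend w j (suc k) r r<g = begin
    digitSum g w (j + suc k) r   ≡⟨ cong (λ x → digitSum g w x r) (+-suc j k) ⟩
    digitSum g w (suc (j + k)) r ≡⟨ digitSum-digit g w (j + k) 0 r (<-≤-trans r<g (g-mono (suc j) k)) ⟩
    digitSum g w (j + k) r       ≡⟨ digitSum-extend w j k r r<g ⟩
    digitSum g w j r             ∎
    where open ≡-Reasoning

  gap : ∀ k → ∃[ c ] suc (g k + c) ≡ g (suc k)
  gap k = m≤n⇒∃[o]m+o≡n (g-< k)

  g-next : ∀ k c → suc (g k + c) ≡ g (suc k) → g (2 + k) ≡ suc ((1 + M) * g (suc k) + c)
  g-next k c gap-c = +-cancelʳ-≡ (g k) _ _ (begin
    g (2 + k) + g k                   ≡⟨ g-rec k ⟩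
    g (1 + k) + (1 + M) * g (1 + k)   ≡⟨ +-comm (g (1 + k)) _ ⟩
    (1 + M) * g (1 + k) + g (1 + k)   ≡⟨ cong ((1 + M) * g (1 + k) +_) (sym gap-c) ⟩
    (1 + M) * g (1 + k) + suc (g k + c) ≡⟨ regroup ((1 + M) * g (1 + k)) (g k) c ⟩
    suc ((1 + M) * g (1 + k) + c) + g k ∎)
    where
    open ≡-Reasoning
    regroup : ∀ a x c → a + suc (x + c) ≡ suc (a + c) + x
    regroup = solve-∀

  shifted : ℕ → ℕ → ℕ
  shifted = digitSum g (λ i → g (pred i))

  -- The gaps c k = g (k + 1) - g k - 1 satisfy c (k + 1) = M g (k + 1) + c k,
  -- so shifting the digits of each gap gives the previous one.
  shifted-gap : ∀ k c → suc (g (suc k) + c) ≡ g (2 + k) → suc (g k + shifted (suc k) c) ≡ g (suc k)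
  shifted-gap zero c _ rewrite g0 | g1 | *-zeroʳ (c div 1) = refl
  shifted-gap (suc k) c gap-c with gap (suc k)
  ... | c′ , gap-c′ = begin
    suc (g (1 + k) + shifted (2 + k) c)                             ≡⟨ cong (λ x → suc (g (1 + k) + shifted (2 + k) x)) c≡ ⟩
    suc (g (1 + k) + shifted (2 + k) (M * g (2 + k) + c′))          ≡⟨ cong (λ x → suc (g (1 + k) + x)) (digitSum-digit g _ (suc k) M c′ c′<) ⟩
    suc (g (1 + k) + (M * g (1 + k) + shifted (1 + k) c′))          ≡⟨ cong suc (sym (+-assoc (g (1 + k)) _ _)) ⟩
    suc ((1 + M) * g (1 + k) + shifted (1 + k) c′)                  ≡⟨ sym (g-next k _ (shifted-gap k c′ gap-c′)) ⟩
    g (2 + k)                                                        ∎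
    where
    open ≡-Reasoning
    c≡ : c ≡ M * g (2 + k) + c′
    c≡ = +-cancelˡ-≡ (g (2 + k)) _ _ (trans (suc-injective (trans gap-c (g-next (suc k) c′ gap-c′))) (+-assoc (g (2 + k)) _ c′))
    c′< : c′ < g (2 + k)
    c′< = subst (c′ <_) gap-c′ (s≤s (m≤n+m c′ (g (1 + k))))

  shifted-top : ∀ j ρ → suc ρ ≡ g (suc j) → g j ≤ suc (shifted j ρ)
  shifted-top zero          ρ _ = subst (_≤ suc (shifted 0 ρ)) (sym g0) z≤n
  shifted-top (suc zero)    ρ _ = subst (_≤ suc (shifted 1 ρ)) (sym g1) (s≤s z≤n)
  shifted-top (suc (suc k)) ρ top-ρ with gap (suc k)
  ... | c , gap-c = ≤-reflexive (begin
    g (2 + k)                                     ≡⟨ g-next k _ (shifted-gap k c gap-c) ⟩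
    suc ((1 + M) * g (1 + k) + shifted (1 + k) c) ≡⟨ cong suc (sym (digitSum-digit g _ (suc k) (1 + M) c c<)) ⟩
    suc (shifted (2 + k) ((1 + M) * g (2 + k) + c)) ≡⟨ cong (λ x → suc (shifted (2 + k) x)) (sym ρ≡) ⟩
    suc (shifted (2 + k) ρ)                       ∎)
    where
    open ≡-Reasoning
    ρ≡ : ρ ≡ (1 + M) * g (2 + k) + c
    ρ≡ = suc-injective (trans top-ρ (g-next (suc k) c gap-c))
    c< : c < g (2 + k)
    c< = subst (c <_) gap-c (s≤s (m≤n+m c (g (1 + k))))

  g-pos : ∀ j → 0 < g (suc j)
  g-pos j = ≤-<-trans z≤n (i<g[1+i] j)

  shifted-suc-≤ : ∀ j r → shifted j (suc r) ≤ suc (shifted j r)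
  shifted-suc-≤ zero    r = z≤n
  shifted-suc-≤ (suc j) r =
    subst (λ x → shifted (suc j) (suc x) ≤ suc (shifted (suc j) x))
          (m+[n∸m]≡n (m-div-n*n≤m r (g (suc j))))
          (digits (r div g (suc j)) _ (m∸m-div-n*n<n r (g (suc j)) (g-pos j)))
    where
    open ≤-Reasoning
    digits : ∀ q ρ → ρ < g (suc j) → shifted (suc j) (suc (q * g (suc j) + ρ)) ≤ suc (shifted (suc j) (q * g (suc j) + ρ))
    digits q ρ ρ<g with m≤n⇒m<n∨m≡n ρ<g
    ... | inj₁ 1+ρ<g = begin
      shifted (suc j) (suc (q * g (suc j) + ρ)) ≡⟨ cong (shifted (suc j)) (sym (+-suc _ ρ)) ⟩
      shifted (suc j) (q * g (suc j) + suc ρ)   ≡⟨ digitSum-digit g _ j q (suc ρ) 1+ρ<g ⟩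
      q * g j + shifted j (suc ρ)               ≤⟨ +-monoʳ-≤ (q * g j) (shifted-suc-≤ j ρ) ⟩
      q * g j + suc (shifted j ρ)               ≡⟨ +-suc (q * g j) _ ⟩
      suc (q * g j + shifted j ρ)               ≡⟨ cong suc (sym (digitSum-digit g _ j q ρ ρ<g)) ⟩
      suc (shifted (suc j) (q * g (suc j) + ρ)) ∎
    ... | inj₂ 1+ρ≡g = begin
      shifted (suc j) (suc (q * g (suc j) + ρ)) ≡⟨ cong (shifted (suc j)) carry ⟩
      shifted (suc j) (suc q * g (suc j) + 0)   ≡⟨ digitSum-digit g _ j (suc q) 0 (g-pos j) ⟩
      suc q * g j + shifted j 0                 ≡⟨ cong (suc q * g j +_) (digitSum-zero g _ j) ⟩
      suc q * g j + 0                           ≡⟨ +-identityʳ _ ⟩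
      g j + q * g j                             ≤⟨ +-monoˡ-≤ (q * g j) (shifted-top j ρ 1+ρ≡g) ⟩
      suc (shifted j ρ) + q * g j               ≡⟨ cong suc (+-comm (shifted j ρ) _) ⟩
      suc (q * g j + shifted j ρ)               ≡⟨ cong suc (sym (digitSum-digit g _ j q ρ ρ<g)) ⟩
      suc (shifted (suc j) (q * g (suc j) + ρ)) ∎
      where
      carry : suc (q * g (suc j) + ρ) ≡ suc q * g (suc j) + 0
      carry = trans (sym (+-suc _ ρ)) (trans (cong (q * g (suc j) +_) 1+ρ≡g)
                (trans (+-comm _ (g (suc j))) (sym (+-identityʳ _))))

  digitSum+shifted : ∀ {w} → Recurrent (2 + M) w → ∀ j r → digitSum g w (suc j) r + w 0 * shifted (suc j) r ≡ w 1 * r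
  digitSum+shifted {w} rw j r =
    trans (digitSum-linear g {w} {λ i → g (pred i)} {g} (w 0) (w 1) (Recurrent-decompose {2 + M} {w} {g} rw g-rec g0 g1) (suc j) r)
          (cong (w 1 *_) (digitSum-self g g1 j r))

  digitSum-strictMono : ∀ {w} → Recurrent (2 + M) w → w 0 < w 1 →
                        ∀ j r → digitSum g w (suc j) r < digitSum g w (suc j) (suc r)
  digitSum-strictMono rw w0<w1 j r =
    <-from-linear-identities (digitSum+shifted rw j r) (digitSum+shifted rw j (suc r)) (shifted-suc-≤ (suc j) r) w0<w1

FibonacciFrom : ℕ → (ℕ → ℕ) → Set
FibonacciFrom a X = ∀ k → a ≤ k → X (2 + k) ≡ X (1 + k) + X k

F-fibonacci : FibonacciFrom 0 F
F-fibonacci k _ = refl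

F-pos : ∀ e → 0 < F (suc e)
F-pos zero    = s≤s z≤n
F-pos (suc e) = ≤-trans (F-pos e) (m≤m+n (F (suc e)) (F e))

fibonacci-addition : ∀ {a} X → FibonacciFrom a X → ∀ {k} → a ≤ k →
                  ∀ m → X (k + suc m) ≡ F m * X k + F (suc m) * X (suc k)
fibonacci-addition X rec {k} a≤k zero = trans (cong X (+-comm k 1)) (sym (+-identityʳ (X (suc k))))
fibonacci-addition X rec {k} a≤k (suc m) = begin
  X (k + suc (suc m))                                  ≡⟨ cong X (+-suc k (suc m)) ⟩
  X (suc k + suc m)                                    ≡⟨ fibonacci-addition X rec (m≤n⇒m≤1+n a≤k) m ⟩
  F m * X (1 + k) + F (suc m) * X (2 + k)              ≡⟨ cong (λ x → F m * X (1 + k) + F (suc m) * x) (rec k a≤k) ⟩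
  F m * X (1 + k) + F (suc m) * (X (1 + k) + X k)      ≡⟨ regroup (F m) (F (suc m)) (X k) (X (1 + k)) ⟩
  F (suc m) * X k + (F (suc m) + F m) * X (suc k)      ∎
  where
  open ≡-Reasoning
  regroup : ∀ a b x y → a * y + b * (y + x) ≡ b * x + (b + a) * y
  regroup = solve-∀

fibonacci-grows : ∀ {a} X → FibonacciFrom a X → ∀ {k} → a ≤ k → 0 < X (suc k) → ∀ e → X k < X (k + suc (suc e))
fibonacci-grows X rec {k} a≤k pos e = begin-strict
  X k                                          <⟨ m<m+n (X k) pos ⟩
  X k + X (suc k)                              ≤⟨ +-mono-≤ (m≤n*m (X k) _ {{>-nonZero (F-pos e)}}) (m≤n*m (X (suc k)) _ {{>-nonZero (F-pos (suc e))}}) ⟩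
  F (suc e) * X k + F (suc (suc e)) * X (suc k) ≡⟨ sym (fibonacci-addition X rec a≤k (suc e)) ⟩
  X (k + suc (suc e))                          ∎
  where open ≤-Reasoning

cassini-step : ∀ j → F (3 + j) * F (1 + j) + F (2 + j) * F j ≡ F (2 + j) * F (2 + j) + F (1 + j) * F (1 + j)
cassini-step j = expand (F (1 + j)) (F j)
  where
  expand : ∀ x y → ((x + y) + x) * x + (x + y) * y ≡ (x + y) * (x + y) + x * x
  expand = solve-∀

cassini-even : ∀ k → F (2 + k * 2) * F (k * 2) + 1 ≡ F (1 + k * 2) * F (1 + k * 2)
cassini-odd  : ∀ k → F (3 + k * 2) * F (1 + k * 2) ≡ F (2 + k * 2) * F (2 + k * 2) + 1

cassini-even zero    = refl
cassini-even (suc k) = +-cancelʳ-≡ (F (2 + k * 2) * F (2 + k * 2)) _ _ (begin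
  F (4 + k * 2) * F (2 + k * 2) + 1 + F (2 + k * 2) * F (2 + k * 2)   ≡⟨ regroup (F (4 + k * 2) * F (2 + k * 2)) _ ⟩
  F (4 + k * 2) * F (2 + k * 2) + (F (2 + k * 2) * F (2 + k * 2) + 1) ≡⟨ cong (F (4 + k * 2) * F (2 + k * 2) +_) (sym (cassini-odd k)) ⟩
  F (4 + k * 2) * F (2 + k * 2) + F (3 + k * 2) * F (1 + k * 2)       ≡⟨ cassini-step (1 + k * 2) ⟩
  F (3 + k * 2) * F (3 + k * 2) + F (2 + k * 2) * F (2 + k * 2)       ∎)
  where
  open ≡-Reasoning
  regroup : ∀ a c → a + 1 + c ≡ a + (c + 1)
  regroup = solve-∀
cassini-odd k = +-cancelʳ-≡ (F (2 + k * 2) * F (k * 2)) _ _ (begin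
  F (3 + k * 2) * F (1 + k * 2) + F (2 + k * 2) * F (k * 2)           ≡⟨ cassini-step (k * 2) ⟩
  F (2 + k * 2) * F (2 + k * 2) + F (1 + k * 2) * F (1 + k * 2)       ≡⟨ cong (F (2 + k * 2) * F (2 + k * 2) +_) (sym (cassini-even k)) ⟩
  F (2 + k * 2) * F (2 + k * 2) + (F (2 + k * 2) * F (k * 2) + 1)     ≡⟨ regroup (F (2 + k * 2) * F (2 + k * 2)) _ ⟩
  F (2 + k * 2) * F (2 + k * 2) + 1 + F (2 + k * 2) * F (k * 2)       ∎)
  where
  open ≡-Reasoning
  regroup : ∀ a c → a + (c + 1) ≡ a + 1 + c
  regroup = solve-∀

fibonacci-step : ∀ {a} X → FibonacciFrom a X → ∀ e → F (2 + e) * F e ≡ F (1 + e) * F (1 + e) + 1 →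
                 ∀ {p} → a ≤ p → X (p + suc e + suc e) + X p ≡ (F e + F (2 + e)) * X (p + suc e)
fibonacci-step X rec e cassini {p} a≤p = begin
  X (p + suc e + suc e) + X p                                          ≡⟨ cong (_+ X p) shift-twice ⟩
  F e * Y + F (1 + e) * (F (1 + e) * X p + F (2 + e) * X (1 + p)) + X p ≡⟨ expand (F e) (F (1 + e)) (F (2 + e)) Y (X p) (X (1 + p)) ⟩
  F e * Y + (F (1 + e) * F (1 + e) + 1) * X p + F (1 + e) * F (2 + e) * X (1 + p)
    ≡⟨ cong (λ x → F e * Y + x * X p + F (1 + e) * F (2 + e) * X (1 + p)) (sym cassini) ⟩
  F e * Y + F (2 + e) * F e * X p + F (1 + e) * F (2 + e) * X (1 + p)  ≡⟨ collect (F e) (F (1 + e)) (F (2 + e)) Y (X p) (X (1 + p)) ⟩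
  F e * Y + F (2 + e) * (F e * X p + F (1 + e) * X (1 + p))           ≡⟨ cong (λ x → F e * Y + F (2 + e) * x) (sym (fibonacci-addition X rec a≤p e)) ⟩
  F e * Y + F (2 + e) * Y                                              ≡⟨ sym (*-distribʳ-+ Y (F e) (F (2 + e))) ⟩
  (F e + F (2 + e)) * Y                                                ∎
  where
  open ≡-Reasoning
  Y = X (p + suc e)
  shift-twice : X (p + suc e + suc e) ≡ F e * Y + F (1 + e) * (F (1 + e) * X p + F (2 + e) * X (1 + p))
  shift-twice = trans (fibonacci-addition X rec (≤-trans a≤p (m≤m+n p (suc e))) e)
                      (cong (λ x → F e * Y + F (1 + e) * x)
                            (trans (cong X (sym (+-suc p (suc e)))) (fibonacci-addition X rec a≤p (suc e))))
  expand : ∀ a b c y x₀ x₁ → a * y + b * (b * x₀ + c * x₁) + x₀ ≡ a * y + (b * b + 1) * x₀ + b * c * x₁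
  expand = solve-∀
  collect : ∀ a b c y x₀ x₁ → a * y + c * a * x₀ + b * c * x₁ ≡ a * y + c * (a * x₀ + b * x₁)
  collect = solve-∀

fibonacci-subsequence : ∀ {a} X → FibonacciFrom a X → ∀ e → F (2 + e) * F e ≡ F (1 + e) * F (1 + e) + 1 →
                        ∀ {j} → a ≤ j → Recurrent (F e + F (2 + e)) (λ i → X (j + i * suc e))
fibonacci-subsequence X rec e cassini {j} a≤j i = begin
  X (j + (2 + i) * d) + X (j + i * d)   ≡⟨ cong (λ x → X x + X (j + i * d)) (index₂ j i d) ⟩
  X (j + i * d + d + d) + X (j + i * d) ≡⟨ fibonacci-step X rec e cassini (≤-trans a≤j (m≤m+n j (i * d))) ⟩
  L * X (j + i * d + d)                 ≡⟨ cong (λ x → L * X x) (sym (index₁ j i d)) ⟩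
  L * X (j + (1 + i) * d)               ∎
  where
  open ≡-Reasoning
  d = suc e
  L = F e + F (2 + e)
  index₂ : ∀ j i d → j + (2 + i) * d ≡ j + i * d + d + d
  index₂ = solve-∀
  index₁ : ∀ j i d → j + (1 + i) * d ≡ j + i * d + d
  index₁ = solve-∀

F∣F[i*d] : ∀ d i → F d ∣ F (i * d)
F∣F[i*d] d       zero    = F d ∣0
F∣F[i*d] zero    (suc i) = F∣F[i*d] zero i
F∣F[i*d] (suc e) (suc i) =
  subst (F (suc e) ∣_)
        (sym (trans (cong F (+-comm (suc e) (i * suc e))) (fibonacci-addition F F-fibonacci {i * suc e} z≤n e)))
        (∣m∣n⇒∣m+n (∣n⇒∣m*n (F e) (F∣F[i*d] (suc e) i)) (m∣m*n (F (suc (i * suc e)))))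

G-*-F : ∀ e i → G (suc e) i * F (suc e) ≡ F (i * suc e)
G-*-F e i = m-div-n*n≡m (F (suc e)) (F-pos e) (F∣F[i*d] (suc e) i)

G-one : ∀ e → G (suc e) 1 ≡ 1
G-one e = *-cancelʳ-≡ _ 1 (F (suc e)) {{>-nonZero (F-pos e)}}
            (trans (G-*-F e 1) (trans (cong F (*-identityˡ (suc e))) (sym (*-identityˡ (F (suc e))))))

G-recurrent : ∀ e → F (2 + e) * F e ≡ F (1 + e) * F (1 + e) + 1 → Recurrent (F e + F (2 + e)) (G (suc e))
G-recurrent e cassini =
  Recurrent-cancel {F e + F (2 + e)} {G (suc e)} {λ i → F (i * suc e)} (F (suc e)) {{>-nonZero (F-pos e)}} (G-*-F e)
    (fibonacci-subsequence F F-fibonacci e cassini {0} z≤n)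

findK≤ : ∀ d x i → findK d x i ≤ i
findK≤ d x zero    = z≤n
findK≤ d x (suc i) with G d (suc i) ≤? x
... | yes _ = ≤-refl
... | no  _ = m≤n⇒m≤1+n (findK≤ d x i)

<G[1+findK] : ∀ d x i → x < G d (suc i) → x < G d (suc (findK d x i))
<G[1+findK] d x zero    x<G = x<G
<G[1+findK] d x (suc i) x<G with G d (suc i) ≤? x
... | yes _   = x<G
... | no  G≰x = <G[1+findK] d x i (≰⇒> G≰x)

module EvenIndex (k : ℕ) where

  e : ℕ
  e = suc (k * 2)

  d : ℕ
  d = suc e

  L M : ℕ
  L = F e + F (2 + e)
  M = L ∸ 2

  L≡2+M : L ≡ 2 + M
  L≡2+M = sym (m+[n∸m]≡n (+-mono-≤ (F-pos (k * 2)) (F-pos (suc e))))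

  open Greedy (G d) M refl (G-one e) (subst (λ L → Recurrent L (G d)) L≡2+M (G-recurrent e (cassini-odd k)))

  s≡digitSum : ∀ V n x J → x ≤ J → s V n d x ≡ digitSum (G d) (λ i → V (n + i * d)) J x
  s≡digitSum V n x J x≤J = begin
    s V n d x                       ≡⟨ sAux≡digitSum V n d j x ⟩
    digitSum (G d) w j x            ≡⟨ sym (digitSum-extend w j (J ∸ j) x (<G[1+findK] d x x (i<g[1+i] x))) ⟩
    digitSum (G d) w (j + (J ∸ j)) x ≡⟨ cong (λ y → digitSum (G d) w y x) (m+[n∸m]≡n (≤-trans (findK≤ d x x) x≤J)) ⟩
    digitSum (G d) w J x            ∎
    where
    open ≡-Reasoning
    j = kIdx d x
    w = λ i → V (n + i * d)

  s-strictMono : ∀ V n → FibonacciFrom 1 V → 1 ≤ n → 0 < V (suc n) → ∀ m → s V n d m < s V n d (suc m)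
  s-strictMono V n rec 1≤n pos m =
    subst₂ _<_ (sym (s≡digitSum V n m (suc m) (n≤1+n m))) (sym (s≡digitSum V n (suc m) (suc m) ≤-refl))
           (digitSum-strictMono w-rec w0<w1 m m)
    where
    w : ℕ → ℕ
    w i = V (n + i * d)
    w-rec : Recurrent (2 + M) w
    w-rec = subst (λ L → Recurrent L w) L≡2+M (fibonacci-subsequence V rec e (cassini-odd k) 1≤n)
    w0<w1 : w 0 < w 1
    w0<w1 = subst₂ _<_ (cong V (sym (+-identityʳ n))) (cong (λ x → V (n + x)) (sym (+-identityʳ d)))
                   (fibonacci-grows V rec 1≤n pos (k * 2))

lemma3p3p2 : (V : ℕ → ℕ) (n d : ℕ)
    → (∀ j → 1 ≤ j → 1 ≤ V j)
    → (∀ j → 3 ≤ j → V j ≡ V (j ∸ 1) + V (j ∸ 2))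
    → 1 ≤ n → 2 ≤ d → 2 ∣ d
    → ∀ m → 1 ≤ m → s V n d m < s V n d (m + 1)
lemma3p3p2 _ _ .0 _ _ _ () (divides zero refl) _ _
lemma3p3p2 V n .(suc k * 2) pos rec 1≤n _ (divides (suc k) refl) m _ =
  subst (λ x → s V n (suc k * 2) m < s V n (suc k * 2) x) (+-comm 1 m)
        (EvenIndex.s-strictMono k V n V-fibonacci 1≤n (pos (suc n) (s≤s z≤n)) m)
  where
  V-fibonacci : FibonacciFrom 1 V
  V-fibonacci j 1≤j = rec (2 + j) (s≤s (s≤s 1≤j))
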